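{- Let $v\geq 8$ and let $C_v$ be the configuration with point set $\mathbb{Z}_v$ and blocks $\{i,i+1,i+3\}$ for $i\in\mathbb{Z}_v$. Then the minimum cardinality of a blocking set of $C_v$ is \[ m(v)=2\left\lfloor\frac{v}{5}\right\rfloor+\varepsilon,\quad\text{where } \varepsilon=\begin{cases}0 & \text{if } v\equiv 0\pmod 5,\\ 1 & \text{if } v\equiv 1\pmod 5,\\ 2 & \text{if } v\equiv 2,3,4\pmod 5.\end{cases}\]
   Context: A blocking set of a configuration with point set $V$ is a subset $Q\subseteq V$ such that every block contains at least one point of $Q$ and at least one point of $V\setminus Q$. (For $v\ge 7$, $C_v$ is a symmetric configuration $v_3$: each block has 3 points, each point lies in 3 blocks, and two points lie together in at most one block.) -}

module Defs where

open import Data.Nat using (ℕ; zero; suc; _+_; _*_; _/_; _%_)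
open import Data.Nat.DivMod using (_mod_)
open import Data.Fin using (Fin; toℕ)
open import Data.Fin.Subset using (Subset; _∈_; _∉_)
open import Data.Product using (_×_)
open import Data.Sum using (_⊎_)

_⊕_ : ∀ {v} → Fin v → ℕ → Fin v
_⊕_ {zero} ()
_⊕_ {suc n} i k = (toℕ i + k) mod (suc n)

IsBlockingSet : (v : ℕ) → Subset v → Set
IsBlockingSet v Q =
  (i : Fin v) →
    ((i ∈ Q) ⊎ ((i ⊕ 1) ∈ Q) ⊎ ((i ⊕ 3) ∈ Q)) ×
    ((i ∉ Q) ⊎ ((i ⊕ 1) ∉ Q) ⊎ ((i ⊕ 3) ∉ Q))

ε : ℕ → ℕ
ε v with v % 5
... | 0 = 0
... | 1 = 1
... | _ = 2

m : ℕ → ℕ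
m v = 2 * (v / 5) + ε v

-- Lower bound, by discharging. Read a blocking set Q as a v-periodic 0/1 sequence x. With a potential
-- ψ on four consecutive points, every five consecutive points satisfy
--   5·x(j) + ψ(j) = 2 + ψ(j+1) + s(j),   s(j) ≥ 0,
-- as soon as the two blocks {j, j+1, j+3} and {j+1, j+2, j+4} are bichromatic. Summing around the
-- cycle the potentials cancel and 5|Q| = 2v + Σ s. The slack s(j) is 1 only on the pattern 10101
-- starting at j, and that pattern at j+2 forces it at j, so Σ s ≠ 1; this excludes 5|Q| = 2v + 1,
-- the only way |Q| < m(v) could be compatible with 5|Q| ≥ 2v.
-- Upper bound. For v = 8, …, 12 there is a minimum blocking set whose cyclic word starts with 011,
-- and inserting 00011 right after that prefix keeps it blocking while adding 5 points and 2 elements.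

module Submission where

open import Data.Bool using (Bool; true; false; T; _∧_)
open import Data.Bool.Properties using (T-∧)
open import Data.Empty using (⊥-elim)
open import Data.Fin using (Fin; toℕ) renaming (zero to fzero; suc to fsuc)
open import Data.Fin.Properties using (toℕ-fromℕ<; toℕ<n)
open import Data.Fin.Subset using (Subset; ∣_∣; _∈_; _∉_)
open import Data.List using (List; []; _∷_; _++_; take; length)
open import Data.List.Properties using (length-++; length-take)
open import Data.Nat using (ℕ; zero; suc; _+_; _*_; _∸_; _⊓_; _≤_; _<_; _%_; _/_; z≤n; s≤s; NonZero)
open import Data.Nat.DivMod using (_mod_; %-distribˡ-+; m%n%n≡m%n; [m+n]%n≡m%n; m<n⇒m%n≡m; m/n≡1+[m∸n]/n)
open import Data.Nat.Properties
open import Algebra.Properties.CommutativeSemigroup +-commutativeSemigroup using (x∙yz≈y∙xz; xy∙z≈xz∙y)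
open import Data.Nat.Tactic.RingSolver using (solve-∀)
open import Data.Product using (Σ; _×_; _,_; proj₁; proj₂; ∃)
open import Data.Sum using (_⊎_; inj₁; inj₂) renaming (map to ⊎-map)
open import Data.Unit using (tt)
open import Data.Vec using (lookup; toList; fromList) renaming ([] to []ᵥ; _∷_ to _∷ᵥ_)
open import Data.Vec.Properties using ([]=⇒lookup; lookup⇒[]=; length-toList; toList∘fromList)
open import Function using (_∘_; Equivalence)
open import Relation.Binary.PropositionalEquality
  using (_≡_; _≢_; refl; sym; trans; cong; cong₂; subst; subst₂; module ≡-Reasoning)

open import Defs

bichromatic : Bool → Bool → Bool → Bool
bichromatic true  true  true  = false
bichromatic false false false = false
bichromatic _     _     _     = true

bit : Bool → ℕ
bit true  = 1
bit false = 0

Window : (ℕ → Bool) → ℕ → Set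
Window x j = T (bichromatic (x j) (x (1 + j)) (x (3 + j)))

∑< : ℕ → (ℕ → ℕ) → ℕ
∑< zero    f = 0
∑< (suc n) f = f 0 + ∑< n (f ∘ suc)

syntax ∑< n (λ j → e) = ∑[ j < n ] e

∑-cong : ∀ n {f g : ℕ → ℕ} → (∀ j → j < n → f j ≡ g j) → ∑< n f ≡ ∑< n g
∑-cong zero    _   = refl
∑-cong (suc n) f≡g = cong₂ _+_ (f≡g 0 (s≤s z≤n)) (∑-cong n (λ j j<n → f≡g (suc j) (s≤s j<n)))

∑-distrib-+ : ∀ n (f g : ℕ → ℕ) → ∑[ j < n ] (f j + g j) ≡ ∑< n f + ∑< n g
∑-distrib-+ zero    f g = refl
∑-distrib-+ (suc n) f g = begin
  (f 0 + g 0) + ∑[ j < n ] (f (suc j) + g (suc j))  ≡⟨ cong (f 0 + g 0 +_) (∑-distrib-+ n (f ∘ suc) (g ∘ suc)) ⟩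
  (f 0 + g 0) + (F + G)                             ≡⟨ +-assoc (f 0) (g 0) _ ⟩
  f 0 + (g 0 + (F + G))                             ≡⟨ cong (f 0 +_) (x∙yz≈y∙xz (g 0) F G) ⟩
  f 0 + (F + (g 0 + G))                             ≡⟨ +-assoc (f 0) F _ ⟨
  (f 0 + F) + (g 0 + G)                             ∎
  where
  open ≡-Reasoning
  F G : ℕ
  F = ∑< n (f ∘ suc)
  G = ∑< n (g ∘ suc)

*-distribˡ-∑ : ∀ k n (f : ℕ → ℕ) → ∑[ j < n ] (k * f j) ≡ k * ∑< n f
*-distribˡ-∑ k zero    f = sym (*-zeroʳ k)
*-distribˡ-∑ k (suc n) f =
  trans (cong (k * f 0 +_) (*-distribˡ-∑ k n (f ∘ suc))) (sym (*-distribˡ-+ k (f 0) _))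

∑-const : ∀ n c → ∑[ _ < n ] c ≡ c * n
∑-const zero    c = sym (*-zeroʳ c)
∑-const (suc n) c = trans (cong (c +_) (∑-const n c)) (sym (*-suc c n))

∑-snoc : ∀ n (f : ℕ → ℕ) → ∑< (suc n) f ≡ ∑< n f + f n
∑-snoc zero    f = +-comm (f 0) 0
∑-snoc (suc n) f = trans (cong (f 0 +_) (∑-snoc n (f ∘ suc))) (sym (+-assoc (f 0) _ _))

∑-rotate : ∀ n (f : ℕ → ℕ) → f n ≡ f 0 → ∑< n (f ∘ suc) ≡ ∑< n f
∑-rotate n f fn≡f0 = +-cancelˡ-≡ (f 0) _ _ (begin
  f 0 + ∑< n (f ∘ suc)  ≡⟨ ∑-snoc n f ⟩
  ∑< n f + f n          ≡⟨ cong (∑< n f +_) fn≡f0 ⟩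
  ∑< n f + f 0          ≡⟨ +-comm (∑< n f) (f 0) ⟩
  f 0 + ∑< n f          ∎)
  where open ≡-Reasoning

f≤∑ : ∀ {n} (f : ℕ → ℕ) {j} → j < n → f j ≤ ∑< n f
f≤∑ {suc n} f {zero}  _         = m≤m+n (f 0) _
f≤∑ {suc n} f {suc j} (s≤s j<n) = ≤-trans (f≤∑ (f ∘ suc) j<n) (m≤n+m _ (f 0))

f+f≤∑ : ∀ {n} (f : ℕ → ℕ) {j k} → j < n → k < n → j ≢ k → f j + f k ≤ ∑< n f
f+f≤∑ {suc n} f {zero}  {zero}  _         _         0≢0 = ⊥-elim (0≢0 refl)
f+f≤∑ {suc n} f {zero}  {suc k} _         (s≤s k<n) _   = +-monoʳ-≤ (f 0) (f≤∑ (f ∘ suc) k<n)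
f+f≤∑ {suc n} f {suc j} {zero}  (s≤s j<n) _         _   =
  subst (_≤ ∑< (suc n) f) (+-comm (f 0) (f (suc j))) (+-monoʳ-≤ (f 0) (f≤∑ (f ∘ suc) j<n))
f+f≤∑ {suc n} f {suc j} {suc k} (s≤s j<n) (s≤s k<n) j≢k =
  ≤-trans (f+f≤∑ (f ∘ suc) j<n k<n (j≢k ∘ cong suc)) (m≤n+m _ (f 0))

∑≡1⇒∃ : ∀ n (f : ℕ → ℕ) → ∑< n f ≡ 1 → ∃ λ j → j < n × f j ≡ 1
∑≡1⇒∃ (suc n) f ∑≡1 with f 0 in f0
... | 0 = let j , j<n , fj≡1 = ∑≡1⇒∃ n (f ∘ suc) ∑≡1 in suc j , s≤s j<n , fj≡1
... | 1 = 0 , s≤s z≤n , f0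

∑≢1 : ∀ n (f : ℕ → ℕ) →
      (∀ {j} → j < n → f j ≡ 1 → ∃ λ k → k < n × k ≢ j × f k ≡ 1) → ∑< n f ≢ 1
∑≢1 n f partner ∑≡1 =
  let j , j<n , fj≡1 = ∑≡1⇒∃ n f ∑≡1
      k , k<n , k≢j , fk≡1 = partner j<n fj≡1
  in <-irrefl refl (subst₂ _≤_ (cong₂ _+_ fj≡1 fk≡1) ∑≡1 (f+f≤∑ f j<n k<n (k≢j ∘ sym)))

∑≢1-if-units-propagate : ∀ n (f : ℕ → ℕ) → 2 < n → (∀ j → f (n + j) ≡ f j) →
                         (∀ j → f (2 + j) ≡ 1 → f j ≡ 1) → ∑< n f ≢ 1
∑≢1-if-units-propagate 1 f (s≤s ())
∑≢1-if-units-propagate 2 f (s≤s (s≤s ()))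
∑≢1-if-units-propagate n@(suc (suc (suc n'))) f _ periodic back = ∑≢1 n f partner
  where
  partner : ∀ {j} → j < n → f j ≡ 1 → ∃ λ k → k < n × k ≢ j × f k ≡ 1
  partner {0} _ f0≡1 =
    suc n' , <-trans (n<1+n _) (n<1+n _) , (λ ()) ,
    back (suc n') (trans (cong f (sym (+-identityʳ n))) (trans (periodic 0) f0≡1))
  partner {1} _ f1≡1 =
    suc (suc n') , n<1+n _ , (λ ()) ,
    back (suc (suc n')) (trans (cong f (+-comm 1 n)) (trans (periodic 1) f1≡1))
  partner {suc (suc j)} j+2<n fj+2≡1 =
    j , <-trans (<-trans (n<1+n j) (n<1+n _)) j+2<n , m≢1+n+m j , back j fj+2≡1

-- Any values for which window-balance and slack≡1⇒10101 below go through would do.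
potential : Bool → Bool → Bool → Bool → ℕ
potential false false false false = 20
potential false false false true  = 18
potential false false true  false = 15
potential false false true  true  = 16
potential false true  false false = 17
potential false true  false true  = 16
potential false true  true  false = 14
potential false true  true  true  = 11
potential true  false false false = 15
potential true  false false true  = 15
potential true  false true  false = 14
potential true  false true  true  = 11
potential true  true  false false = 12
potential true  true  false true  = 5
potential true  true  true  false = 9
potential true  true  true  true  = 0

-- Truncated subtraction, but window-balance shows that it never truncates when both blocks are bichromatic.
slack : Bool → Bool → Bool → Bool → Bool → ℕ
slack a b c d e = 5 * bit a + potential a b c d ∸ (2 + potential b c d e)

window-balance : ∀ a b c d e → T (bichromatic a b d) → T (bichromatic b c e) →
                 5 * bit a + potential a b c d ≡ 2 + potential b c d e + slack a b c d e
window-balance false false false false false () _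
window-balance false false false false true  () _
window-balance false false false true  false _  ()
window-balance false false false true  true  _  _  = refl
window-balance false false true  false false () _
window-balance false false true  false true  () _
window-balance false false true  true  false _  _  = refl
window-balance false false true  true  true  _  _  = refl
window-balance false true  false false false _  _  = refl
window-balance false true  false false true  _  _  = refl
window-balance false true  false true  false _  _  = refl
window-balance false true  false true  true  _  _  = refl
window-balance false true  true  false false _  _  = refl
window-balance false true  true  false true  _  ()
window-balance false true  true  true  false _  _  = refl
window-balance false true  true  true  true  _  ()
window-balance true  false false false false _  ()
window-balance true  false false false true  _  _  = refl
window-balance true  false false true  false _  ()
window-balance true  false false true  true  _  _  = refl
window-balance true  false true  false false _  _  = refl
window-balance true  false true  false true  _  _  = refl
window-balance true  false true  true  false _  _  = refl
window-balance true  false true  true  true  _  _  = refl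
window-balance true  true  false false false _  _  = refl
window-balance true  true  false false true  _  _  = refl
window-balance true  true  false true  false () _
window-balance true  true  false true  true  () _
window-balance true  true  true  false false _  _  = refl
window-balance true  true  true  false true  _  ()
window-balance true  true  true  true  false () _
window-balance true  true  true  true  true  () _

slack≡1⇒10101 : ∀ a b c d e → T (bichromatic b c e) → slack a b c d e ≡ 1 →
                a ≡ true × b ≡ false × c ≡ true × d ≡ false × e ≡ true
slack≡1⇒10101 false false false false false () _
slack≡1⇒10101 false false false false true  _  ()
slack≡1⇒10101 false false false true  false () _
slack≡1⇒10101 false false false true  true  _  ()
slack≡1⇒10101 false false true  false false _  ()
slack≡1⇒10101 false false true  false true  _  ()
slack≡1⇒10101 false false true  true  false _  ()
slack≡1⇒10101 false false true  true  true  _  ()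
slack≡1⇒10101 false true  false false false _  ()
slack≡1⇒10101 false true  false false true  _  ()
slack≡1⇒10101 false true  false true  false _  ()
slack≡1⇒10101 false true  false true  true  _  ()
slack≡1⇒10101 false true  true  false false _  ()
slack≡1⇒10101 false true  true  false true  () _
slack≡1⇒10101 false true  true  true  false _  ()
slack≡1⇒10101 false true  true  true  true  () _
slack≡1⇒10101 true  false false false false () _
slack≡1⇒10101 true  false false false true  _  ()
slack≡1⇒10101 true  false false true  false () _
slack≡1⇒10101 true  false false true  true  _  ()
slack≡1⇒10101 true  false true  false false _  ()
slack≡1⇒10101 true  false true  false true  _  refl = refl , refl , refl , refl , refl
slack≡1⇒10101 true  false true  true  false _  ()
slack≡1⇒10101 true  false true  true  true  _  ()
slack≡1⇒10101 true  true  false false false _  ()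
slack≡1⇒10101 true  true  false false true  _  ()
slack≡1⇒10101 true  true  false true  false _  ()
slack≡1⇒10101 true  true  false true  true  _  ()
slack≡1⇒10101 true  true  true  false false _  ()
slack≡1⇒10101 true  true  true  false true  () _
slack≡1⇒10101 true  true  true  true  false _  ()
slack≡1⇒10101 true  true  true  true  true  () _

slack-propagates : ∀ a b {c d e f g} → T (bichromatic a b d) → T (bichromatic b c e) →
                   T (bichromatic d e g) → slack c d e f g ≡ 1 → slack a b c d e ≡ 1
slack-propagates a b {c} {d} {e} {f} {g} ab∙d bc∙e de∙g slack≡1 with slack≡1⇒10101 c d e f g de∙g slack≡1
... | refl , refl , refl , refl , refl = forced a b ab∙d bc∙e
  where
  forced : ∀ a b → T (bichromatic a b false) → T (bichromatic b true true) → slack a b true false true ≡ 1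
  forced true  false _  _  = refl
  forced false false () _
  forced _     true  _  ()

module Discharging {v} (x : ℕ → Bool) (periodic : ∀ j → x (v + j) ≡ x j) (windows : ∀ j → Window x j)
  where

  potentialAt : ℕ → ℕ
  potentialAt j = potential (x j) (x (1 + j)) (x (2 + j)) (x (3 + j))

  slackAt : ℕ → ℕ
  slackAt j = slack (x j) (x (1 + j)) (x (2 + j)) (x (3 + j)) (x (4 + j))

  shift : ∀ k j → x (k + (v + j)) ≡ x (k + j)
  shift k j = trans (cong x (x∙yz≈y∙xz k v j)) (periodic (k + j))

  potentialAt-periodic : ∀ j → potentialAt (v + j) ≡ potentialAt j
  potentialAt-periodic j rewrite shift 0 j | shift 1 j | shift 2 j | shift 3 j = refl

  slackAt-periodic : ∀ j → slackAt (v + j) ≡ slackAt j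
  slackAt-periodic j rewrite shift 0 j | shift 1 j | shift 2 j | shift 3 j | shift 4 j = refl

  5*count≡2*v+slack : 5 * ∑[ j < v ] bit (x j) ≡ 2 * v + ∑< v slackAt
  5*count≡2*v+slack = +-cancelʳ-≡ P _ _ (begin
    5 * ∑[ j < v ] bit (x j) + P
      ≡⟨ cong (_+ P) (*-distribˡ-∑ 5 v (bit ∘ x)) ⟨
    ∑[ j < v ] (5 * bit (x j)) + P
      ≡⟨ ∑-distrib-+ v (λ j → 5 * bit (x j)) potentialAt ⟨
    ∑[ j < v ] (5 * bit (x j) + potentialAt j)
      ≡⟨ ∑-cong v (λ j _ → window-balance _ _ _ _ _ (windows j) (windows (1 + j))) ⟩
    ∑[ j < v ] (2 + potentialAt (1 + j) + slackAt j)
      ≡⟨ ∑-distrib-+ v (λ j → 2 + potentialAt (1 + j)) slackAt ⟩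
    ∑[ j < v ] (2 + potentialAt (1 + j)) + S
      ≡⟨ cong (_+ S) (∑-distrib-+ v (λ _ → 2) (potentialAt ∘ suc)) ⟩
    ∑[ _ < v ] 2 + ∑< v (potentialAt ∘ suc) + S
      ≡⟨ cong₂ (λ c p → c + p + S) (∑-const v 2) (∑-rotate v potentialAt potential-wraps) ⟩
    2 * v + P + S
      ≡⟨ xy∙z≈xz∙y (2 * v) P S ⟩
    2 * v + S + P ∎)
    where
    open ≡-Reasoning
    P S : ℕ
    P = ∑< v potentialAt
    S = ∑< v slackAt
    potential-wraps : potentialAt v ≡ potentialAt 0
    potential-wraps = trans (cong potentialAt (sym (+-identityʳ v))) (potentialAt-periodic 0)

  total-slack≢1 : 2 < v → ∑< v slackAt ≢ 1
  total-slack≢1 2<v = ∑≢1-if-units-propagate v slackAt 2<v slackAt-periodic λ j →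
    slack-propagates _ _ (windows j) (windows (1 + j)) (windows (3 + j))

m[5+v]≡2+m[v] : ∀ v → m (5 + v) ≡ 2 + m v
m[5+v]≡2+m[v] v = cong (_+ ε v) (trans (cong (2 *_) (m/n≡1+[m∸n]/n {5 + v} {5} (m≤m+n 5 v))) (*-suc 2 (v / 5)))

-- C ≢ 1 is only needed for v ≡ 2 (mod 5), where 5q = 2v + 1 has the solution q = m v ∸ 1.
5q≡2v+C⇒m≤q : ∀ v q C → 5 * q ≡ 2 * v + C → C ≢ 1 → m v ≤ q
5q≡2v+C⇒m≤q 0 q             _ _    _   = z≤n
5q≡2v+C⇒m≤q 1 0             _ ()   _
5q≡2v+C⇒m≤q 1 (suc q)       _ _    _   = s≤s z≤n
5q≡2v+C⇒m≤q 2 0             _ ()   _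
5q≡2v+C⇒m≤q 2 1             _ refl C≢1 = ⊥-elim (C≢1 refl)
5q≡2v+C⇒m≤q 2 (suc (suc q)) _ _    _   = s≤s (s≤s z≤n)
5q≡2v+C⇒m≤q 3 0             _ ()   _
5q≡2v+C⇒m≤q 3 1             _ ()   _
5q≡2v+C⇒m≤q 3 (suc (suc q)) _ _    _   = s≤s (s≤s z≤n)
5q≡2v+C⇒m≤q 4 0             _ ()   _
5q≡2v+C⇒m≤q 4 1             _ ()   _
5q≡2v+C⇒m≤q 4 (suc (suc q)) _ _    _   = s≤s (s≤s z≤n)
5q≡2v+C⇒m≤q (suc (suc (suc (suc (suc v))))) q C e C≢1 = subtract-10 q (trans e (2[5+v]+C≡10+[2v+C] v C))
  where
  2[5+v]+C≡10+[2v+C] : ∀ v C → 2 * (5 + v) + C ≡ 10 + (2 * v + C)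
  2[5+v]+C≡10+[2v+C] = solve-∀
  subtract-10 : ∀ q → 5 * q ≡ 10 + (2 * v + C) → m (5 + v) ≤ q
  subtract-10 0 ()
  subtract-10 1 ()
  subtract-10 (suc (suc q)) e′ = subst (_≤ 2 + q) (sym (m[5+v]≡2+m[v] v))
    (s≤s (s≤s (5q≡2v+C⇒m≤q v q C (+-cancelˡ-≡ 10 _ _ (trans (sym (*-distribˡ-+ 5 2 q)) e′)) C≢1)))

_‼_ : List Bool → ℕ → Bool
[]       ‼ _     = false
(b ∷ _)  ‼ zero  = b
(_ ∷ bs) ‼ suc j = bs ‼ j

indicator : ∀ {n} → Subset (suc n) → ℕ → Bool
indicator {n} Q j = toList Q ‼ (j % suc n)

lookup≡toList‼ : ∀ {n} (Q : Subset n) i → lookup Q i ≡ toList Q ‼ toℕ i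
lookup≡toList‼ (b ∷ᵥ _) fzero    = refl
lookup≡toList‼ (_ ∷ᵥ Q) (fsuc i) = lookup≡toList‼ Q i

∣∣≡∑toList‼ : ∀ {n} (Q : Subset n) → ∣ Q ∣ ≡ ∑[ j < n ] bit (toList Q ‼ j)
∣∣≡∑toList‼ []ᵥ          = refl
∣∣≡∑toList‼ (true  ∷ᵥ Q) = cong suc (∣∣≡∑toList‼ Q)
∣∣≡∑toList‼ (false ∷ᵥ Q) = ∣∣≡∑toList‼ Q

module _ {n} (Q : Subset (suc n)) where

  private
    v : ℕ
    v = suc n

  ∣∣≡∑indicator : ∣ Q ∣ ≡ ∑[ j < v ] bit (indicator Q j)
  ∣∣≡∑indicator = trans (∣∣≡∑toList‼ Q)
    (∑-cong v λ j j<v → cong (bit ∘ (toList Q ‼_)) (sym (m<n⇒m%n≡m j<v)))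

  indicator-periodic : ∀ j → indicator Q (v + j) ≡ indicator Q j
  indicator-periodic j = cong (toList Q ‼_) (trans (cong (_% v) (+-comm v j)) ([m+n]%n≡m%n j v))

  lookup≡indicator : ∀ i → lookup Q i ≡ indicator Q (toℕ i)
  lookup≡indicator i = trans (lookup≡toList‼ Q i) (cong (toList Q ‼_) (sym (m<n⇒m%n≡m (toℕ<n i))))

  lookup-⊕ : ∀ i k → lookup Q (i ⊕ k) ≡ indicator Q (k + toℕ i)
  lookup-⊕ i k = trans (lookup≡toList‼ Q (i ⊕ k))
    (cong (toList Q ‼_) (trans (toℕ-fromℕ< _) (cong (_% v) (+-comm (toℕ i) k))))

  lookup-mod : ∀ j → lookup Q (j mod v) ≡ indicator Q j
  lookup-mod j = trans (lookup≡toList‼ Q (j mod v)) (cong (toList Q ‼_) (toℕ-fromℕ< _))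

  lookup-mod-⊕ : ∀ j k → lookup Q ((j mod v) ⊕ k) ≡ indicator Q (k + j)
  lookup-mod-⊕ j k = trans (lookup-⊕ (j mod v) k) (cong (toList Q ‼_) (begin
    (k + toℕ (j mod v)) % v  ≡⟨ cong (λ t → (k + t) % v) (toℕ-fromℕ< _) ⟩
    (k + j % v) % v          ≡⟨ %-distribˡ-+ k (j % v) v ⟩
    (k % v + j % v % v) % v  ≡⟨ cong (λ t → (k % v + t) % v) (m%n%n≡m%n j v) ⟩
    (k % v + j % v) % v      ≡⟨ %-distribˡ-+ k j v ⟨
    (k + j) % v              ∎))
    where open ≡-Reasoning

bichromatic⁺ : ∀ {a b c} → a ≡ true ⊎ b ≡ true ⊎ c ≡ true → a ≢ true ⊎ b ≢ true ⊎ c ≢ true →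
               T (bichromatic a b c)
bichromatic⁺ {true}  {true}  {true}  _ (inj₁ a≢true)        = ⊥-elim (a≢true refl)
bichromatic⁺ {true}  {true}  {true}  _ (inj₂ (inj₁ b≢true)) = ⊥-elim (b≢true refl)
bichromatic⁺ {true}  {true}  {true}  _ (inj₂ (inj₂ c≢true)) = ⊥-elim (c≢true refl)
bichromatic⁺ {true}  {true}  {false} _ _ = tt
bichromatic⁺ {true}  {false} {_}     _ _ = tt
bichromatic⁺ {false} {true}  {_}     _ _ = tt
bichromatic⁺ {false} {false} {true}  _ _ = tt
bichromatic⁺ {false} {false} {false} (inj₁ ())        _
bichromatic⁺ {false} {false} {false} (inj₂ (inj₁ ())) _
bichromatic⁺ {false} {false} {false} (inj₂ (inj₂ ())) _

bichromatic⁻ : ∀ {a b c} → T (bichromatic a b c) →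
               (a ≡ true ⊎ b ≡ true ⊎ c ≡ true) × (a ≢ true ⊎ b ≢ true ⊎ c ≢ true)
bichromatic⁻ {true}  {true}  {true}  ()
bichromatic⁻ {true}  {true}  {false} _ = inj₁ refl , inj₂ (inj₂ λ ())
bichromatic⁻ {true}  {false} {_}     _ = inj₁ refl , inj₂ (inj₁ λ ())
bichromatic⁻ {false} {true}  {_}     _ = inj₂ (inj₁ refl) , inj₁ λ ()
bichromatic⁻ {false} {false} {true}  _ = inj₂ (inj₂ refl) , inj₁ λ ()
bichromatic⁻ {false} {false} {false} ()

bichromatic-cong : ∀ {a a′ b b′ c c′} → a ≡ a′ → b ≡ b′ → c ≡ c′ →
                   T (bichromatic a b c) → T (bichromatic a′ b′ c′)
bichromatic-cong refl refl refl abc = abc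

Blocked : ∀ {n} → Subset n → Fin n → Fin n → Fin n → Set
Blocked Q i j k = (i ∈ Q ⊎ j ∈ Q ⊎ k ∈ Q) × (i ∉ Q ⊎ j ∉ Q ⊎ k ∉ Q)

module _ {n} (Q : Subset n) {i j k : Fin n} where

  blocked⇒bichromatic : Blocked Q i j k → T (bichromatic (lookup Q i) (lookup Q j) (lookup Q k))
  blocked⇒bichromatic (meets , avoids) =
    bichromatic⁺ (⊎-map []=⇒lookup (⊎-map []=⇒lookup []=⇒lookup) meets)
                 (⊎-map (_∘ lookup⇒[]= i Q) (⊎-map (_∘ lookup⇒[]= j Q) (_∘ lookup⇒[]= k Q)) avoids)

  bichromatic⇒blocked : T (bichromatic (lookup Q i) (lookup Q j) (lookup Q k)) → Blocked Q i j k
  bichromatic⇒blocked ijk =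
    let meets , avoids = bichromatic⁻ ijk
    in ⊎-map (lookup⇒[]= i Q) (⊎-map (lookup⇒[]= j Q) (lookup⇒[]= k Q)) meets ,
       ⊎-map (_∘ []=⇒lookup) (⊎-map (_∘ []=⇒lookup) (_∘ []=⇒lookup)) avoids

module _ {n} (Q : Subset (suc n)) where

  blocking⇒windows : IsBlockingSet (suc n) Q → ∀ j → Window (indicator Q) j
  blocking⇒windows blocking j =
    bichromatic-cong (lookup-mod Q j) (lookup-mod-⊕ Q j 1) (lookup-mod-⊕ Q j 3)
      (blocked⇒bichromatic Q (blocking (j mod suc n)))

  windows⇒blocking : (∀ j → j < suc n → Window (indicator Q) j) → IsBlockingSet (suc n) Q
  windows⇒blocking windows i =
    bichromatic⇒blocked Q
      (bichromatic-cong (sym (lookup≡indicator Q i)) (sym (lookup-⊕ Q i 1)) (sym (lookup-⊕ Q i 3))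
        (windows (toℕ i) (toℕ<n i)))

  m≤∣blockingSet∣ : 2 < suc n → IsBlockingSet (suc n) Q → m (suc n) ≤ ∣ Q ∣
  m≤∣blockingSet∣ 2<v blocking =
    5q≡2v+C⇒m≤q (suc n) ∣ Q ∣ (∑< (suc n) slackAt)
      (trans (cong (5 *_) (∣∣≡∑indicator Q)) 5*count≡2*v+slack) (total-slack≢1 2<v)
    where open Discharging {suc n} (indicator Q) (indicator-periodic Q) (blocking⇒windows blocking)

allWindows : List Bool → Bool
allWindows (a ∷ b ∷ c ∷ d ∷ rest) = bichromatic a b d ∧ allWindows (b ∷ c ∷ d ∷ rest)
allWindows _                      = true

allWindows-at : ∀ xs {j} → T (allWindows xs) → 3 + j < length xs → Window (xs ‼_) j
allWindows-at (a ∷ b ∷ c ∷ d ∷ rest) {zero}  all _ = proj₁ (Equivalence.to T-∧ all)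
allWindows-at (a ∷ b ∷ c ∷ d ∷ rest) {suc j} all (s≤s bound) =
  allWindows-at (b ∷ c ∷ d ∷ rest) (proj₂ (Equivalence.to T-∧ all)) bound
allWindows-at []              _ ()
allWindows-at (_ ∷ [])         _ (s≤s ())
allWindows-at (_ ∷ _ ∷ [])     _ (s≤s (s≤s ()))
allWindows-at (_ ∷ _ ∷ _ ∷ []) _ (s≤s (s≤s (s≤s ())))

‼-++ˡ : ∀ xs {ys j} → j < length xs → (xs ++ ys) ‼ j ≡ xs ‼ j
‼-++ˡ (x ∷ xs) {j = zero}  _         = refl
‼-++ˡ (x ∷ xs) {j = suc j} (s≤s j<n) = ‼-++ˡ xs j<n

‼-++ʳ : ∀ xs {ys} j → (xs ++ ys) ‼ (length xs + j) ≡ ys ‼ j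
‼-++ʳ []       j = refl
‼-++ʳ (x ∷ xs) j = ‼-++ʳ xs j

‼-take : ∀ k xs {j} → j < k → take k xs ‼ j ≡ xs ‼ j
‼-take (suc k) []       _         = refl
‼-take (suc k) (x ∷ xs) {zero}  _ = refl
‼-take (suc k) (x ∷ xs) {suc j} (s≤s j<k) = ‼-take k xs j<k

‼-cyclic : ∀ xs {v} .{{_ : NonZero v}} → length xs ≡ v → 3 ≤ v →
           ∀ t → t < v + 3 → (xs ++ take 3 xs) ‼ t ≡ xs ‼ (t % v)
‼-cyclic xs refl 3≤v t t<v+3 with <-≤-connex t (length xs)
... | inj₁ t<v = trans (‼-++ˡ xs t<v) (cong (xs ‼_) (sym (m<n⇒m%n≡m t<v)))
... | inj₂ v≤t with m≤n⇒∃[o]m+o≡n v≤t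
... | u , refl = begin
  (xs ++ take 3 xs) ‼ (length xs + u)  ≡⟨ ‼-++ʳ xs u ⟩
  take 3 xs ‼ u                        ≡⟨ ‼-take 3 xs u<3 ⟩
  xs ‼ u                               ≡⟨ cong (xs ‼_) (m<n⇒m%n≡m (≤-trans u<3 3≤v)) ⟨
  xs ‼ (u % length xs)                 ≡⟨ cong (xs ‼_) ([m+n]%n≡m%n u (length xs)) ⟨
  xs ‼ ((u + length xs) % length xs)   ≡⟨ cong (λ t → xs ‼ (t % length xs)) (+-comm u (length xs)) ⟩
  xs ‼ ((length xs + u) % length xs)   ∎
  where
  open ≡-Reasoning
  u<3 : u < 3
  u<3 = +-cancelˡ-< (length xs) u 3 t<v+3

necklace⇒blocking : ∀ {n} (Q : Subset (suc n)) → 2 < suc n →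
                    T (allWindows (toList Q ++ take 3 (toList Q))) → IsBlockingSet (suc n) Q
necklace⇒blocking {n} Q 2<v all = windows⇒blocking Q window
  where
  v : ℕ
  v = suc n
  L : List Bool
  L = toList Q ++ take 3 (toList Q)
  length-L : length L ≡ v + 3
  length-L = trans (length-++ (toList Q)) (cong₂ _+_ (length-toList Q)
    (trans (length-take 3 (toList Q)) (trans (cong (3 ⊓_) (length-toList Q)) (m≤n⇒m⊓n≡m 2<v))))
  window : ∀ j → j < v → Window (indicator Q) j
  window j j<v = bichromatic-cong (unroll z≤n) (unroll (s≤s z≤n)) (unroll ≤-refl)
    (allWindows-at L all (subst (3 + j <_) (sym length-L) (in-range ≤-refl)))
    where
    in-range : ∀ {k} → k ≤ 3 → k + j < v + 3
    in-range {k} k≤3 = subst (k + j <_) (+-comm 3 v) (+-mono-≤-< k≤3 j<v)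
    unroll : ∀ {k} → k ≤ 3 → L ‼ (k + j) ≡ indicator Q (k + j)
    unroll {k} k≤3 = ‼-cyclic (toList Q) (length-toList Q) 2<v (k + j) (in-range k≤3)

Necklace : ℕ → Set
Necklace v = Σ (List Bool) λ rest → let xs = false ∷ true ∷ true ∷ rest in
  length xs ≡ v × T (allWindows (xs ++ take 3 xs)) × ∣ fromList xs ∣ ≡ m v

-- The five windows starting in the prefix 01100011 are bichromatic, after which allWindows continues on
-- 011 followed by rest: the same computation as for the shorter necklace, so its check is reused as is.
insert-block : ∀ {v} → Necklace v → Necklace (5 + v)
insert-block {v} (rest , refl , all , size) =
  false ∷ false ∷ false ∷ true ∷ true ∷ rest , refl , all , trans (cong (2 +_) size) (sym (m[5+v]≡2+m[v] v))

-- The words for v = 8, …, 12 were found by exhaustive search.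
necklace : ∀ d → Necklace (8 + d)
necklace 0 = false ∷ false ∷ true ∷ true ∷ false ∷ [] , refl , tt , refl
necklace 1 = false ∷ false ∷ false ∷ true ∷ true ∷ false ∷ [] , refl , tt , refl
necklace 2 = false ∷ false ∷ false ∷ true ∷ true ∷ false ∷ false ∷ [] , refl , tt , refl
necklace 3 = false ∷ false ∷ false ∷ true ∷ true ∷ true ∷ false ∷ false ∷ [] , refl , tt , refl
necklace 4 = false ∷ false ∷ true ∷ true ∷ false ∷ false ∷ true ∷ true ∷ false ∷ [] , refl , tt , refl
necklace (suc (suc (suc (suc (suc d))))) = insert-block (necklace d)

Attained : ℕ → Set
Attained v = Σ (Subset v) (λ Q → IsBlockingSet v Q × ∣ Q ∣ ≡ m v)

necklace⇒attained : ∀ {v} → Necklace v → Attained v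
necklace⇒attained (rest , refl , all , size) =
  fromList xs ,
  necklace⇒blocking (fromList xs) (s≤s (s≤s (s≤s z≤n)))
    (subst (λ ys → T (allWindows (ys ++ take 3 ys))) (sym (toList∘fromList xs)) all) ,
  size
  where
  xs : List Bool
  xs = false ∷ true ∷ true ∷ rest

minimum-attained : ∀ v → 8 ≤ v → Attained v
minimum-attained v 8≤v = subst Attained (m+[n∸m]≡n 8≤v) (necklace⇒attained (necklace (v ∸ 8)))

theorem5 : (v : ℕ) → 8 ≤ v →
    (Σ (Subset v) (λ Q → IsBlockingSet v Q × ∣ Q ∣ ≡ m v)) ×
    ((Q : Subset v) → IsBlockingSet v Q → m v ≤ ∣ Q ∣)
theorem5 v@(suc _) 8≤v =
  minimum-attained v 8≤v , λ Q → m≤∣blockingSet∣ Q (≤-trans (s≤s (s≤s (s≤s z≤n))) 8≤v)
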